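{- For every graph $G$ of order $n$, there exists a clique covering $\mathcal{C}$ of $E(G)$ such that for each non-isolated vertex $v\in V(G)$, $$val_{\mathcal{C}}(v)+\frac{n}{\alpha_G(v)}\leq n+1.$$
   Context: All graphs are finite, simple and undirected. A clique of $G$ is a set of pairwise adjacent vertices. A clique covering of $E(G)$ is a family $\mathcal{C}$ of cliques of $G$ such that every edge of $G$ lies in at least one member of $\mathcal{C}$. For a vertex $v$, its valency $val_{\mathcal{C}}(v)$ is the number of cliques in $\mathcal{C}$ containing $v$. For a vertex $v$, $N(v)$ is its (open) neighborhood and $\alpha_G(v)=\alpha(G[N(v)])$ is the maximum number of pairwise non-adjacent vertices in $N(v)$ (so $\alpha_G(v)\ge 1$ when $v$ is non-isolated). -}

module Defs where

open import Data.Nat using (ℕ; suc; _+_; _*_; _≤_)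
open import Data.Fin using (Fin)
open import Data.Fin.Subset using (Subset; _∈_; _⊆_; ∣_∣)
open import Data.List using (List; length; filter)
open import Data.Fin.Subset.Properties using (_∈?_)
open import Data.List.Membership.Propositional renaming (_∈_ to _∈ₗ_)
open import Data.Product using (Σ; ∃; _×_)
open import Relation.Binary.PropositionalEquality using (_≡_; _≢_)
open import Relation.Nullary using (¬_)
open import Relation.Unary using (Decidable)

record Graph (n : ℕ) : Set₁ where
  field
    Adj      : Fin n → Fin n → Set
    adj?     : ∀ u v → Relation.Nullary.Dec (Adj u v)
    sym      : ∀ {u v} → Adj u v → Adj v u
    irrefl   : ∀ {u} → ¬ Adj u u

open Graph public

IsClique : ∀ {n} → Graph n → Subset n → Set
IsClique G C = ∀ {u v} → u ∈ C → v ∈ C → u ≢ v → Adj G u v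

IsCliqueCovering : ∀ {n} → Graph n → List (Subset n) → Set
IsCliqueCovering G 𝒞 =
  (∀ {C} → C ∈ₗ 𝒞 → IsClique G C) ×
  (∀ {u v} → Adj G u v → ∃ λ C → C ∈ₗ 𝒞 × u ∈ C × v ∈ C)

val : ∀ {n} → List (Subset n) → Fin n → ℕ
val 𝒞 v = length (filter (λ C → v ∈? C) 𝒞)

InN : ∀ {n} → Graph n → Fin n → Fin n → Set
InN G v u = Adj G v u

IsIndepInN : ∀ {n} → Graph n → Fin n → Subset n → Set
IsIndepInN G v S =
  (∀ {u} → u ∈ S → Adj G v u) ×
  (∀ {u w} → u ∈ S → w ∈ S → ¬ Adj G u w)

-- a = α_G(v) = α(G[N(v)]): maximum size of an independent subset of N(v)
IsAlpha : ∀ {n} → Graph n → Fin n → ℕ → Set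
IsAlpha G v a =
  (∃ λ S → IsIndepInN G v S × ∣ S ∣ ≡ a) ×
  (∀ S → IsIndepInN G v S → ∣ S ∣ ≤ a)

NonIsolated : ∀ {n} → Graph n → Fin n → Set
NonIsolated G v = ∃ λ u → Adj G v u

module Submission where

-- A simplicial vertex (one whose neighbourhood is a clique, α = 1) must have valency 1, so the closed
-- neighbourhood N[s] of every simplicial vertex s is taken as one clique of the cover. The remaining
-- edges, between non-simplicial vertices (α ≥ 2), are covered by induction on the set W of such vertices,
-- counting the simplicial vertices towards the order m throughout. If a vertex x of W has a neighbour y
-- in W, both are removed; the neighbours of x or y in W whose edge to them lies in no simplicial clique
-- are grouped into those seen by both, by x only and by y only, each group is matched greedily, and every
-- matched pair or unmatched vertex, together with the removed vertices that see it, becomes a clique.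
-- Every other vertex gains at most one clique while m grows by 2, which the bound k + m/α ≤ m + 1 absorbs
-- as α ≥ 2. At x, the unmatched vertices of a group together with one simplicial vertex from each
-- simplicial clique through x are independent neighbours, while matched vertices come in pairs; this
-- bounds the valency of x.

open import Data.Empty using (⊥-elim)
open import Data.Fin using (Fin; _≟_)
import Data.Fin as Fin
open import Data.Fin.Induction using () renaming (<-wellFounded to Fin-<-wellFounded)
open import Data.Fin.Properties using (all?; any?; ¬∀⟶∃¬; _<?_; <-cmp; <-asym)
open import Data.Fin.Subset using (Subset; _∈_; _∉_; _⊆_; ∣_∣)
open import Data.Fin.Subset.Properties using (_∈?_; p⊂q⇒∣p∣<∣q∣)
open import Data.List using (List; []; _∷_; length; filter; allFin; map; _++_; foldr)
open import Data.List.Properties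
  using (length-++; length-++-sucʳ; length-map; length-tabulate; length-filter; filter-++; filter-all; filter-none)
open import Data.List.Membership.Propositional using (find) renaming (_∈_ to _∈ₗ_; _∉_ to _∉ₗ_)
open import Data.List.Membership.Propositional.Properties
  using (∈-filter⁺; ∈-filter⁻; ∈-allFin; ∈-++⁺ˡ; ∈-++⁺ʳ; ∈-++⁻; ∈-map⁺; ∈-map⁻; ∈-∃++)
open import Data.List.Relation.Binary.Permutation.Propositional
  using (_↭_; ↭-refl; ↭-prep; ↭-swap; ↭-trans; ↭-sym; ↭⇒↭ₛ)
open import Data.List.Relation.Binary.Permutation.Propositional.Properties
  using (↭-length; ∈-resp-↭; map⁺; filter-↭; shift)
import Data.List.Relation.Binary.Permutation.Setoid.Properties as PermutationSetoid
open import Data.List.Relation.Unary.All as All using (All; []; _∷_)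
import Data.List.Relation.Unary.All.Properties as Allₚ
open import Data.List.Relation.Unary.All.Properties using (anti-mono)
open import Data.List.Relation.Unary.All.Properties.Core using (¬Any⇒All¬)
open import Data.List.Relation.Unary.AllPairs as AllPairs using (AllPairs; []; _∷_)
import Data.List.Relation.Unary.AllPairs.Properties as AllPairsₚ
open import Data.List.Relation.Unary.Any as Any using (Any; here; there)
open import Data.List.Relation.Unary.Unique.Propositional using (Unique)
import Data.List.Relation.Unary.Unique.Propositional.Properties as Uniqueₚ
open import Data.List.Relation.Unary.Unique.Propositional.Properties using (Unique[x∷xs]⇒x∉xs)
open import Data.Maybe using (Maybe; just; nothing)
open import Data.Nat using (ℕ; suc; _+_; _*_; _∸_; _≤_; _<_; _⊔_; z≤n; s≤s)
open import Data.Nat.Induction using (<-wellFounded)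
open import Data.Nat.Properties
  using (module ≤-Reasoning; ≤-refl; ≤-reflexive; ≤-trans; ≤-total; n≤1+n; m≤n⇒m≤1+n; m≤m+n; m≤n+m;
         m+n≤o⇒n≤o; m+[n∸m]≡n; m≤m⊔n; m≤n⊔m; ⊔-lub; +-identityʳ; +-suc; +-comm; +-assoc; +-monoˡ-≤;
         +-monoʳ-≤; +-mono-≤; *-identityˡ; *-identityʳ; *-distribʳ-+; *-distribˡ-+; *-monoˡ-≤; *-monoʳ-≤;
         *-cancelʳ-≤; +-commutativeSemigroup)
open import Data.Nat.Tactic.RingSolver using (solve-∀)
open import Algebra.Properties.CommutativeSemigroup +-commutativeSemigroup using (x∙yz≈y∙xz)
open import Data.Product using (_,_; _×_; ∃; proj₁; proj₂)
open import Data.Sum using (_⊎_; inj₁; inj₂; [_,_]′)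
open import Data.Vec using (tabulate)
open import Data.Vec.Properties using (lookup∘tabulate; lookup⇒[]=; []=⇒lookup)
open import Function using (_∘_)
open import Induction.WellFounded using (Acc; acc)
open import Relation.Binary.Definitions using (tri<; tri≈; tri>)
open import Relation.Binary.PropositionalEquality
open import Relation.Nullary using (¬_; Dec; yes; no; ¬?; does)
open import Relation.Nullary.Decidable using (dec-true; _×-dec_; _⊎-dec_; _→-dec_)
open import Relation.Unary using (Pred; Decidable)

open import Defs renaming (sym to adj-sym)


-- Arithmetic of the valency bound

ValencyBound : ℕ → ℕ → ℕ → Set
ValencyBound m s k = k * s + m ≤ suc m * s

module _ where
  open ≤-Reasoning

  n≤n*s : ∀ n {s} → 1 ≤ s → n ≤ n * s
  n≤n*s n {s} 1≤s = ≤-trans (≤-reflexive (sym (*-identityʳ n))) (*-monoʳ-≤ n 1≤s)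

  bound-mono-order : ∀ {m m′ s k} → 1 ≤ s → m ≤ m′ → ValencyBound m s k → ValencyBound m′ s k
  bound-mono-order {m} {m′} {s} {k} 1≤s m≤m′ bound = begin
    k * s + m′        ≡⟨ cong (k * s +_) (sym (m+[n∸m]≡n m≤m′)) ⟩
    k * s + (m + r)   ≡⟨ sym (+-assoc (k * s) m r) ⟩
    k * s + m + r     ≤⟨ +-mono-≤ bound (n≤n*s r 1≤s) ⟩
    suc m * s + r * s ≡⟨ sym (*-distribʳ-+ s (suc m) r) ⟩
    suc (m + r) * s   ≡⟨ cong (λ o → suc o * s) (m+[n∸m]≡n m≤m′) ⟩
    suc m′ * s        ∎
    where r = m′ ∸ m

  bound-mono-α : ∀ {m s s′ k} → 1 ≤ s → s ≤ s′ → ValencyBound m s k → ValencyBound m s′ k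
  bound-mono-α {m} {s@(suc _)} {s′} {k} _ s≤s′ bound = begin
    k * s′ + m            ≡⟨ cong (λ t → k * t + m) (sym (m+[n∸m]≡n s≤s′)) ⟩
    k * (s + r) + m       ≡⟨ regroup k s r m ⟩
    (k * s + m) + k * r   ≤⟨ +-mono-≤ bound (*-monoˡ-≤ r k≤1+m) ⟩
    suc m * s + suc m * r ≡⟨ sym (*-distribˡ-+ (suc m) s r) ⟩
    suc m * (s + r)       ≡⟨ cong (suc m *_) (m+[n∸m]≡n s≤s′) ⟩
    suc m * s′            ∎
    where
    r = s′ ∸ s
    regroup : ∀ k s r m → k * (s + r) + m ≡ (k * s + m) + k * r
    regroup = solve-∀
    k≤1+m : k ≤ suc m
    k≤1+m = *-cancelʳ-≤ k (suc m) s (≤-trans (m≤m+n (k * s) m) bound)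

  bound-antimono-val : ∀ {m s k k′} → k ≤ k′ → ValencyBound m s k′ → ValencyBound m s k
  bound-antimono-val {m} {s} k≤k′ = ≤-trans (+-monoˡ-≤ m (*-monoˡ-≤ s k≤k′))

  bound-suc : ∀ {m s k} → 2 ≤ s → ValencyBound m s k → ValencyBound (2 + m) s (suc k)
  bound-suc {m} {s} {k} 2≤s bound = begin
    suc k * s + (2 + m)     ≡⟨ lhs k s m ⟩
    (k * s + m) + (2 + s)   ≤⟨ +-mono-≤ bound (+-monoˡ-≤ s 2≤s) ⟩
    suc m * s + (s + s)     ≡⟨ rhs m s ⟩
    suc (2 + m) * s         ∎
    where
    lhs : ∀ k s m → suc k * s + (2 + m) ≡ (k * s + m) + (2 + s)
    lhs = solve-∀
    rhs : ∀ m s → suc m * s + (s + s) ≡ suc (2 + m) * s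
    rhs = solve-∀

  bound-endpoint : ∀ {m s k p₁ u₁ p₂ u₂} → 2 ≤ s → k + u₁ ≤ s → k + u₂ ≤ s →
                   2 + k + ((2 * p₁ + u₁) + (2 * p₂ + u₂)) ≤ m →
                   ValencyBound m s (k + ((p₁ + u₁) + (p₂ + u₂)))
  bound-endpoint {m} {s} {k} {p₁} {u₁} {p₂} {u₂} 2≤s k+u₁≤s k+u₂≤s m₀≤m =
    bound-mono-order {k = k + ((p₁ + u₁) + (p₂ + u₂))} (≤-trans (s≤s z≤n) 2≤s) m₀≤m (begin
      (k + ((p₁ + u₁) + (p₂ + u₂))) * s + (2 + k + ((2 * p₁ + u₁) + (2 * p₂ + u₂)))
        ≡⟨ lhs k p₁ u₁ p₂ u₂ s ⟩
      X + (2 + (k + u₁) + u₂ + (p₁ + p₂) * 2)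
        ≤⟨ +-monoʳ-≤ X (+-mono-≤ (+-mono-≤ (+-mono-≤ 2≤s k+u₁≤s) (m+n≤o⇒n≤o k k+u₂≤s))
                                 (*-monoʳ-≤ (p₁ + p₂) 2≤s)) ⟩
      X + (s + s + s + (p₁ + p₂) * s)
        ≡⟨ rhs k p₁ u₁ p₂ u₂ s ⟩
      suc (2 + k + ((2 * p₁ + u₁) + (2 * p₂ + u₂))) * s ∎)
    where
    X = (k + u₁) * s + (p₁ + p₂ + u₂) * s
    lhs : ∀ k p₁ u₁ p₂ u₂ s →
          (k + ((p₁ + u₁) + (p₂ + u₂))) * s + (2 + k + ((2 * p₁ + u₁) + (2 * p₂ + u₂))) ≡
          (k + u₁) * s + (p₁ + p₂ + u₂) * s + (2 + (k + u₁) + u₂ + (p₁ + p₂) * 2)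
    lhs = solve-∀
    rhs : ∀ k p₁ u₁ p₂ u₂ s →
          (k + u₁) * s + (p₁ + p₂ + u₂) * s + (s + s + s + (p₁ + p₂) * s) ≡
          suc (2 + k + ((2 * p₁ + u₁) + (2 * p₂ + u₂))) * s
    rhs = solve-∀

  bound-endpoint-edge : ∀ {m s k p u} → 2 ≤ s → k + u ≤ s → 2 + k + (2 * p + u) ≤ m →
                        ValencyBound m s (k + (1 + (p + u)))
  bound-endpoint-edge {m} {s} {k} {p} {u} 2≤s k+u≤s m₀≤m =
    bound-mono-order {k = k + (1 + (p + u))} (≤-trans (s≤s z≤n) 2≤s) m₀≤m (begin
      (k + (1 + (p + u))) * s + (2 + k + (2 * p + u)) ≡⟨ lhs k p u s ⟩
      X + (2 + (k + u) + p * 2)                    ≤⟨ +-monoʳ-≤ X (+-mono-≤ (+-mono-≤ 2≤s k+u≤s) (*-monoʳ-≤ p 2≤s)) ⟩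
      X + (s + s + p * s)                          ≡⟨ rhs k p u s ⟩
      suc (2 + k + (2 * p + u)) * s                ∎)
    where
    X = (k + (1 + (p + u))) * s
    lhs : ∀ k p u s → (k + (1 + (p + u))) * s + (2 + k + (2 * p + u)) ≡
                      (k + (1 + (p + u))) * s + (2 + (k + u) + p * 2)
    lhs = solve-∀
    rhs : ∀ k p u s → (k + (1 + (p + u))) * s + (s + s + p * s) ≡ suc (2 + k + (2 * p + u)) * s
    rhs = solve-∀

  bound-isolated : ∀ {m s k} → 2 ≤ s → k ≤ s → suc k ≤ m → ValencyBound m s k
  bound-isolated {m} {s} {k} 2≤s k≤s k<m =
    bound-mono-order {k = k} (≤-trans (s≤s z≤n) 2≤s) k<m (begin
      k * s + suc k       ≤⟨ +-monoʳ-≤ (k * s) (+-mono-≤ (≤-trans (s≤s z≤n) 2≤s) k≤s) ⟩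
      k * s + (s + s)     ≡⟨ rhs k s ⟩
      suc (suc k) * s     ∎)
    where
    rhs : ∀ k s → k * s + (s + s) ≡ suc (suc k) * s
    rhs = solve-∀

  bound-valency≤1 : ∀ {m s k} → 1 ≤ s → k ≤ 1 → ValencyBound m s k
  bound-valency≤1 {m} {s} {k} 1≤s k≤1 = begin
    k * s + m      ≤⟨ +-mono-≤ (*-monoˡ-≤ s k≤1) (n≤n*s m 1≤s) ⟩
    1 * s + m * s  ≡⟨ cong (_+ m * s) (*-identityˡ s) ⟩
    suc m * s      ∎

one-of-three : ∀ {a b c} → (a ≤ 1 × b ≡ 0 × c ≡ 0) ⊎ (a ≡ 0 × b ≤ 1 × c ≡ 0) ⊎ (a ≡ 0 × b ≡ 0 × c ≤ 1) →
               a + (b + c) ≤ 1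
one-of-three {a} (inj₁ (a≤1 , refl , refl))        = subst (_≤ 1) (sym (+-identityʳ a)) a≤1
one-of-three {b = b} (inj₂ (inj₁ (refl , b≤1 , refl))) = subst (_≤ 1) (sym (+-identityʳ b)) b≤1
one-of-three (inj₂ (inj₂ (refl , refl , c≤1)))     = c≤1

-- Lists, subsets and valencies

¬→⇒×¬ : ∀ {a b} {A : Set a} {B : Set b} → Dec A → ¬ (A → B) → A × ¬ B
¬→⇒×¬ (yes a) ¬[A→B] = a , λ b → ¬[A→B] (λ _ → b)
¬→⇒×¬ (no ¬a) ¬[A→B] = ⊥-elim (¬[A→B] (λ a → ⊥-elim (¬a a)))

≢∧≮⇒> : ∀ {n} {s t : Fin n} → t ≢ s → ¬ s Fin.< t → t Fin.< s
≢∧≮⇒> {s = s} {t} t≢s s≮t with <-cmp t s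
... | tri< t<s _ _ = t<s
... | tri≈ _ t≡s _ = ⊥-elim (t≢s t≡s)
... | tri> _ _ s<t = ⊥-elim (s≮t s<t)

allPairs-strengthen : ∀ {a r s} {A : Set a} {R : A → A → Set r} {S : A → A → Set s} {xs : List A} →
                      (∀ {x y} → x ∈ₗ xs → y ∈ₗ xs → R x y → S x y) → AllPairs R xs → AllPairs S xs
allPairs-strengthen         R⇒S []                = []
allPairs-strengthen {xs = x ∷ xs} R⇒S (x-xs ∷ xs-ok) =
  All.tabulate (λ y∈ → R⇒S (here refl) (there y∈) (All.lookup x-xs y∈))
  ∷ allPairs-strengthen (λ x∈ y∈ → R⇒S (there x∈) (there y∈)) xs-ok

allPairs-lookup : ∀ {a r} {A : Set a} {R : A → A → Set r} {xs : List A} → AllPairs R xs →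
                  ∀ {x y} → x ∈ₗ xs → y ∈ₗ xs → x ≢ y → R x y ⊎ R y x
allPairs-lookup (x-xs ∷ _)  (here refl) (here refl) x≢y = ⊥-elim (x≢y refl)
allPairs-lookup (x-xs ∷ _)  (here refl) (there y∈)  _   = inj₁ (All.lookup x-xs y∈)
allPairs-lookup (x-xs ∷ _)  (there x∈)  (here refl) _   = inj₂ (All.lookup x-xs x∈)
allPairs-lookup (_ ∷ xs-ok) (there x∈)  (there y∈)  x≢y = allPairs-lookup xs-ok x∈ y∈ x≢y

module _ {a p q} {A : Set a} {P : Pred A p} {Q : Pred A q} (P? : Decidable P) (Q? : Decidable Q) where

  length-filter-disjoint : (∀ {x} → P x → ¬ Q x) → ∀ xs →
                           length (filter P? xs) + length (filter Q? xs) ≤ length xs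
  length-filter-disjoint P⇒¬Q []       = z≤n
  length-filter-disjoint P⇒¬Q (x ∷ xs) with ih ← length-filter-disjoint P⇒¬Q xs | P? x | Q? x
  ... | yes px | yes qx = ⊥-elim (P⇒¬Q px qx)
  ... | yes _  | no _   = s≤s ih
  ... | no _   | yes _  = ≤-trans (≤-reflexive (+-suc _ _)) (s≤s ih)
  ... | no _   | no _   = m≤n⇒m≤1+n ih

module _ {a} {A : Set a} where

  unique-constant⇒length≤1 : ∀ {xs : List A} → Unique xs →
                             (∀ {x y} → x ∈ₗ xs → y ∈ₗ xs → x ≡ y) → length xs ≤ 1
  unique-constant⇒length≤1 []                          _      = z≤n
  unique-constant⇒length≤1 (_ ∷ [])                    _      = ≤-refl
  unique-constant⇒length≤1 ((x≢y ∷ _) ∷ _) constant =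
    ⊥-elim (x≢y (constant (here refl) (there (here refl))))

module _ {n : ℕ} where

  open import Data.List.Membership.DecPropositional (_≟_ {n}) using () renaming (_∈?_ to _∈ₗ?_)

  subsetOf : ∀ {p} {P : Pred (Fin n) p} → Decidable P → Subset n
  subsetOf P? = tabulate (does ∘ P?)

  ∈-subsetOf⁺ : ∀ {p} {P : Pred (Fin n) p} (P? : Decidable P) {x} → P x → x ∈ subsetOf P?
  ∈-subsetOf⁺ P? {x} px = lookup⇒[]= x _ (trans (lookup∘tabulate _ x) (dec-true (P? x) px))

  ∈-subsetOf⁻ : ∀ {p} {P : Pred (Fin n) p} (P? : Decidable P) {x} → x ∈ subsetOf P? → P x
  ∈-subsetOf⁻ P? {x} x∈ with P? x | trans (sym (lookup∘tabulate (does ∘ P?) x)) ([]=⇒lookup x∈)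
  ... | yes px | _ = px

  fromList : List (Fin n) → Subset n
  fromList xs = subsetOf (_∈ₗ? xs)

  ∈-fromList⁺ : ∀ xs {x} → x ∈ₗ xs → x ∈ fromList xs
  ∈-fromList⁺ xs = ∈-subsetOf⁺ (_∈ₗ? xs)

  ∈-fromList⁻ : ∀ xs {x} → x ∈ fromList xs → x ∈ₗ xs
  ∈-fromList⁻ xs = ∈-subsetOf⁻ (_∈ₗ? xs)

  length≤∣fromList∣ : ∀ {xs} → Unique xs → length xs ≤ ∣ fromList xs ∣
  length≤∣fromList∣ {[]}     []             = z≤n
  length≤∣fromList∣ {x ∷ xs} (x∉xs ∷ unique) =
    ≤-trans (s≤s (length≤∣fromList∣ unique)) (p⊂q⇒∣p∣<∣q∣ (grow , x , ∈-fromList⁺ (x ∷ xs) (here refl) , x∉))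
    where
    grow : fromList xs ⊆ fromList (x ∷ xs)
    grow y∈ = ∈-fromList⁺ (x ∷ xs) (there (∈-fromList⁻ xs y∈))
    x∉ : x ∉ fromList xs
    x∉ x∈ = All.lookup x∉xs (∈-fromList⁻ xs x∈) refl

module _ {n : ℕ} where

  val-++ : ∀ (𝒞 𝒟 : List (Subset n)) v → val (𝒞 ++ 𝒟) v ≡ val 𝒞 v + val 𝒟 v
  val-++ 𝒞 𝒟 v = trans (cong length (filter-++ (v ∈?_) 𝒞 𝒟)) (length-++ (filter (v ∈?_) 𝒞))

  val-↭ : ∀ {𝒞 𝒟 : List (Subset n)} → 𝒞 ↭ 𝒟 → ∀ v → val 𝒞 v ≡ val 𝒟 v
  val-↭ 𝒞↭𝒟 v = ↭-length (filter-↭ (v ∈?_) 𝒞↭𝒟)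

  val-none : ∀ (𝒞 : List (Subset n)) {v} → (∀ {C} → C ∈ₗ 𝒞 → v ∉ C) → val 𝒞 v ≡ 0
  val-none _ v∉ = cong length (filter-none _ (All.tabulate v∉))

  val-all : ∀ (𝒞 : List (Subset n)) {v} → (∀ {C} → C ∈ₗ 𝒞 → v ∈ C) → val 𝒞 v ≡ length 𝒞
  val-all _ v∈ = cong length (filter-all _ (All.tabulate v∈))

  val-singleton≤1 : ∀ (C : Subset n) v → val (C ∷ []) v ≤ 1
  val-singleton≤1 C v = length-filter (v ∈?_) (C ∷ [])

  val-∷ : ∀ (C : Subset n) 𝒞 v → val (C ∷ 𝒞) v ≡ val (C ∷ []) v + val 𝒞 v
  val-∷ C = val-++ (C ∷ [])

  val-singleton-cong : ∀ {C D : Subset n} {v} → (v ∈ C → v ∈ D) → (v ∈ D → v ∈ C) →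
                       val (C ∷ []) v ≡ val (D ∷ []) v
  val-singleton-cong {C} {D} {v} C⇒D D⇒C with v ∈? C | v ∈? D
  ... | yes _   | yes _   = refl
  ... | no  _   | no  _   = refl
  ... | yes v∈C | no  v∉D = ⊥-elim (v∉D (C⇒D v∈C))
  ... | no  v∉C | yes v∈D = ⊥-elim (v∉C (D⇒C v∈D))

  val-map : ∀ {a} {A : Set a} (f : A → Subset n) xs v → val (map f xs) v ≡ length (filter (λ x → v ∈? f x) xs)
  val-map f []       v = refl
  val-map f (x ∷ xs) v with v ∈? f x
  ... | yes _ = cong suc (val-map f xs v)
  ... | no  _ = val-map f xs v

-- Greedy matchings

module _ {n : ℕ} (G : Graph n) where

  Apart : Fin n → Fin n → Set
  Apart u v = u ≢ v × ¬ Adj G u v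

  Matching : Set
  Matching = List (Fin n × Fin n) × List (Fin n)

  pairs : Matching → List (Fin n × Fin n)
  pairs = proj₁

  singles : Matching → List (Fin n)
  singles = proj₂

  extract : Fin n → List (Fin n) → Maybe (Fin n × List (Fin n))
  extract w []       = nothing
  extract w (s ∷ ss) with adj? G w s
  ... | yes _ = just (s , ss)
  ... | no  _ with extract w ss
  ...   | just (t , ts) = just (t , s ∷ ts)
  ...   | nothing       = nothing

  -- w is paired with the first unmatched vertex adjacent to it, so the unmatched vertices stay pairwise
  -- non-adjacent.
  insert : Fin n → Matching → Matching
  insert w (ps , ss) with extract w ss
  ... | just (s , ss′) = (w , s) ∷ ps , ss′
  ... | nothing        = ps , w ∷ ss

  match : List (Fin n) → Matching
  match = foldr insert ([] , [])

  extract-just : ∀ {w s} ss {ss′} → extract w ss ≡ just (s , ss′) → Adj G w s × ss ↭ s ∷ ss′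
  extract-just {w} (t ∷ ts) eq with adj? G w t
  extract-just {w} (t ∷ ts) refl | yes w~t = w~t , ↭-refl
  ... | no _ with extract w ts in eq′
  extract-just {w} (t ∷ ts) refl | no _ | just (s , ts′) =
    let w~s , ts↭ = extract-just ts eq′ in w~s , ↭-trans (↭-prep t ts↭) (↭-swap t s ↭-refl)

  extract-nothing : ∀ {w} ss → extract w ss ≡ nothing → All (¬_ ∘ Adj G w) ss
  extract-nothing []       _  = []
  extract-nothing {w} (t ∷ ts) eq with adj? G w t
  ... | no ¬w~t with extract w ts in eq′
  extract-nothing {w} (t ∷ ts) refl | no ¬w~t | nothing = ¬w~t ∷ extract-nothing ts eq′

  extract-AllPairs : ∀ {R : Fin n → Fin n → Set} {w s} ss {ss′} → extract w ss ≡ just (s , ss′) →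
                     AllPairs R ss → AllPairs R ss′
  extract-AllPairs {w = w} (t ∷ ts) eq (t-ts ∷ ts-ok) with adj? G w t
  extract-AllPairs {w = w} (t ∷ ts) refl (t-ts ∷ ts-ok) | yes _ = ts-ok
  ... | no _ with extract w ts in eq′
  extract-AllPairs {w = w} (t ∷ ts) refl (t-ts ∷ ts-ok) | no _ | just (s , ts′) =
    anti-mono (λ u∈ → ∈-resp-↭ (↭-sym (proj₂ (extract-just ts eq′))) (there u∈)) t-ts
      ∷ extract-AllPairs ts eq′ ts-ok

  match-sound : ∀ ws → All (λ (a , b) → Adj G a b × a ∈ₗ ws × b ∈ₗ ws) (pairs (match ws))
                     × All (_∈ₗ ws) (singles (match ws))
  match-sound []       = [] , []
  match-sound (w ∷ ws) with match ws | match-sound ws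
  ... | ps , ss | ps-ok , ss-ok with extract w ss in eq
  ... | just (s , ss′) =
    let w~s , ss↭ = extract-just ss eq in
    (w~s , here refl , there (All.lookup ss-ok (∈-resp-↭ (↭-sym ss↭) (here refl))))
      ∷ All.map (λ (a~b , a∈ , b∈) → a~b , there a∈ , there b∈) ps-ok ,
    All.tabulate (λ u∈ → there (All.lookup ss-ok (∈-resp-↭ (↭-sym ss↭) (there u∈))))
  ... | nothing = All.map (λ (a~b , a∈ , b∈) → a~b , there a∈ , there b∈) ps-ok ,
                  here refl ∷ All.map there ss-ok

  match-size : ∀ ws → 2 * length (pairs (match ws)) + length (singles (match ws)) ≡ length ws
  match-size []       = refl
  match-size (w ∷ ws) with match ws | match-size ws
  ... | ps , ss | size with extract w ss in eq
  ... | just (s , ss′) = trans (regroup (length ps) (length ss′))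
    (cong suc (trans (cong (2 * length ps +_) (sym (↭-length (proj₂ (extract-just ss eq))))) size))
    where
    regroup : ∀ p u → 2 * suc p + u ≡ suc (2 * p + suc u)
    regroup = solve-∀
  ... | nothing = trans (+-suc (2 * length ps) (length ss)) (cong suc size)

  match-singles-apart : ∀ ws → Unique ws → AllPairs Apart (singles (match ws))
  match-singles-apart []       _                = []
  match-singles-apart (w ∷ ws) (w∉ws ∷ unique) with match ws | match-sound ws | match-singles-apart ws unique
  ... | ps , ss | _ , ss⊆ws | apart with extract w ss in eq
  ... | just _  = extract-AllPairs ss eq apart
  ... | nothing =
    All.tabulate (λ s∈ → All.lookup w∉ws (All.lookup ss⊆ws s∈) , All.lookup (extract-nothing ss eq) s∈) ∷ apart

  InMatching : Fin n → Matching → Set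
  InMatching u M = Any (λ p → u ≡ proj₁ p ⊎ u ≡ proj₂ p) (pairs M) ⊎ u ∈ₗ singles M

  insert-new : ∀ w M → InMatching w (insert w M)
  insert-new w (ps , ss) with extract w ss
  ... | just _  = inj₁ (here (inj₁ refl))
  ... | nothing = inj₂ (here refl)

  insert-keeps : ∀ w M {u} → InMatching u M → InMatching u (insert w M)
  insert-keeps w (ps , ss) u∈ with extract w ss in eq | u∈
  ... | just _ | inj₁ u∈ps = inj₁ (there u∈ps)
  ... | just (s , ss′) | inj₂ u∈ss with ∈-resp-↭ (proj₂ (extract-just ss eq)) u∈ss
  ...   | here u≡s   = inj₁ (here (inj₂ u≡s))
  ...   | there u∈ss′ = inj₂ u∈ss′
  insert-keeps w (ps , ss) u∈ | nothing | inj₁ u∈ps = inj₁ u∈ps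
  insert-keeps w (ps , ss) u∈ | nothing | inj₂ u∈ss = inj₂ (there u∈ss)

  match-covers : ∀ ws {u} → u ∈ₗ ws → InMatching u (match ws)
  match-covers (w ∷ ws) (here refl) = insert-new w (match ws)
  match-covers (w ∷ ws) (there u∈)  = insert-keeps w (match ws) (match-covers ws u∈)

  IsCliqueList : List (Fin n) → Set
  IsCliqueList xs = ∀ {u v} → u ∈ₗ xs → v ∈ₗ xs → u ≢ v → Adj G u v

  cliqueList-∷ : ∀ {x xs} → (∀ {v} → v ∈ₗ xs → Adj G x v) → IsCliqueList xs → IsCliqueList (x ∷ xs)
  cliqueList-∷ x~xs xs-clique (here refl) (here refl) u≢v = ⊥-elim (u≢v refl)
  cliqueList-∷ x~xs xs-clique (here refl) (there v∈)  _   = x~xs v∈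
  cliqueList-∷ x~xs xs-clique (there u∈)  (here refl) _   = adj-sym G (x~xs u∈)
  cliqueList-∷ x~xs xs-clique (there u∈)  (there v∈)  u≢v = xs-clique u∈ v∈ u≢v

  fromList-clique : ∀ xs → IsCliqueList xs → IsClique G (fromList xs)
  fromList-clique xs clique u∈ v∈ = clique (∈-fromList⁻ xs u∈) (∈-fromList⁻ xs v∈)

  pairClique : List (Fin n) → Fin n × Fin n → Subset n
  pairClique E (a , b) = fromList (a ∷ b ∷ E)

  singleClique : List (Fin n) → Fin n → Subset n
  singleClique E a = fromList (a ∷ E)

  cliquesOf : List (Fin n) → Matching → List (Subset n)
  cliquesOf E (ps , ss) = map (pairClique E) ps ++ map (singleClique E) ss

  matchCliques : List (Fin n) → List (Fin n) → List (Subset n)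
  matchCliques E ws = cliquesOf E (match ws)

  matchCliques-⊆ : ∀ E ws {C u} → C ∈ₗ matchCliques E ws → u ∈ C → u ∈ₗ ws ⊎ u ∈ₗ E
  matchCliques-⊆ E ws {u = u} C∈ u∈C with match-sound ws | ∈-++⁻ (map (pairClique E) (pairs (match ws))) C∈
  ... | ps-ok , _ | inj₁ C∈ps with ∈-map⁻ (pairClique E) C∈ps
  ...   | (a , b) , p∈ , refl with ∈-fromList⁻ (a ∷ b ∷ E) u∈C | All.lookup ps-ok p∈
  ...     | here refl         | _ , a∈ , _ = inj₁ a∈
  ...     | there (here refl) | _ , _ , b∈ = inj₁ b∈
  ...     | there (there u∈E) | _          = inj₂ u∈E
  matchCliques-⊆ E ws {u = u} C∈ u∈C | _ , ss-ok | inj₂ C∈ss with ∈-map⁻ (singleClique E) C∈ss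
  ...   | a , a∈ss , refl with ∈-fromList⁻ (a ∷ E) u∈C
  ...     | here refl  = inj₁ (All.lookup ss-ok a∈ss)
  ...     | there u∈E  = inj₂ u∈E

  matchCliques-clique : ∀ E ws → (∀ {a e} → a ∈ₗ ws → e ∈ₗ E → Adj G a e) → IsCliqueList E →
                        ∀ {C} → C ∈ₗ matchCliques E ws → IsClique G C
  matchCliques-clique E ws ws~E E-clique C∈ with match-sound ws | ∈-++⁻ (map (pairClique E) (pairs (match ws))) C∈
  ... | ps-ok , _ | inj₁ C∈ps with ∈-map⁻ (pairClique E) C∈ps
  ...   | (a , b) , p∈ , refl with All.lookup ps-ok p∈
  ...     | a~b , a∈ , b∈ = fromList-clique (a ∷ b ∷ E)
    (cliqueList-∷ (λ { (here refl) → a~b ; (there e∈) → ws~E a∈ e∈ })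
      (cliqueList-∷ (ws~E b∈) E-clique))
  matchCliques-clique E ws ws~E E-clique C∈ | _ , ss-ok | inj₂ C∈ss with ∈-map⁻ (singleClique E) C∈ss
  ...   | a , a∈ss , refl = fromList-clique (a ∷ E) (cliqueList-∷ (ws~E (All.lookup ss-ok a∈ss)) E-clique)

  matchCliques-covers : ∀ E ws {w} → w ∈ₗ ws →
                        ∃ λ C → C ∈ₗ matchCliques E ws × w ∈ C × (∀ {e} → e ∈ₗ E → e ∈ C)
  matchCliques-covers E ws w∈ with match-covers ws w∈
  ... | inj₁ w∈ps with find w∈ps
  ...   | (a , b) , p∈ , inj₁ refl =
    pairClique E (a , b) , ∈-++⁺ˡ (∈-map⁺ (pairClique E) p∈) , ∈-fromList⁺ (a ∷ b ∷ E) (here refl) ,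
    λ e∈ → ∈-fromList⁺ (a ∷ b ∷ E) (there (there e∈))
  ...   | (a , b) , p∈ , inj₂ refl =
    pairClique E (a , b) , ∈-++⁺ˡ (∈-map⁺ (pairClique E) p∈) , ∈-fromList⁺ (a ∷ b ∷ E) (there (here refl)) ,
    λ e∈ → ∈-fromList⁺ (a ∷ b ∷ E) (there (there e∈))
  matchCliques-covers E ws {w} w∈ | inj₂ w∈ss =
    singleClique E w , ∈-++⁺ʳ (map (pairClique E) (pairs (match ws))) (∈-map⁺ (singleClique E) w∈ss) ,
    ∈-fromList⁺ (w ∷ E) (here refl) , λ e∈ → ∈-fromList⁺ (w ∷ E) (there e∈)

  partCount : List (Fin n) → ℕ
  partCount ws = length (pairs (match ws)) + length (singles (match ws))

  matchCliques-val-∈ : ∀ E ws {e} → e ∈ₗ E → val (matchCliques E ws) e ≡ partCount ws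
  matchCliques-val-∈ E ws {e} e∈E = begin
    val (matchCliques E ws) e ≡⟨ val-all (matchCliques E ws) e∈C ⟩
    length (matchCliques E ws) ≡⟨ length-++ (map (pairClique E) ps) ⟩
    length (map (pairClique E) ps) + length (map (singleClique E) ss)
      ≡⟨ cong₂ _+_ (length-map (pairClique E) ps) (length-map (singleClique E) ss) ⟩
    length ps + length ss ∎
    where
    open ≡-Reasoning
    ps = pairs (match ws)
    ss = singles (match ws)
    e∈C : ∀ {C} → C ∈ₗ matchCliques E ws → e ∈ C
    e∈C C∈ with ∈-++⁻ (map (pairClique E) ps) C∈
    ... | inj₁ C∈ps with ∈-map⁻ (pairClique E) C∈ps
    ...   | (a , b) , _ , refl = ∈-fromList⁺ (a ∷ b ∷ E) (there (there e∈E))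
    e∈C C∈ | inj₂ C∈ss with ∈-map⁻ (singleClique E) C∈ss
    ...   | a , _ , refl = ∈-fromList⁺ (a ∷ E) (there e∈E)

  matchCliques-val-∉ : ∀ E ws {v} → v ∉ₗ E → v ∉ₗ ws → val (matchCliques E ws) v ≡ 0
  matchCliques-val-∉ E ws v∉E v∉ws =
    val-none (matchCliques E ws) (λ C∈ v∈C → [ v∉ws , v∉E ]′ (matchCliques-⊆ E ws C∈ v∈C))

  private
    ∉-singleClique : ∀ {E w v} → v ≢ w → v ∉ₗ E → v ∉ singleClique E w
    ∉-singleClique {E} {w} v≢w v∉E v∈ with ∈-fromList⁻ (w ∷ E) v∈
    ... | here v≡w  = v≢w v≡w
    ... | there v∈E = v∉E v∈E

    extract-val : ∀ {w} ss {s ss′} → extract w ss ≡ just (s , ss′) → ∀ (f : Fin n → Subset n) v →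
                  val (map f ss) v ≡ val (f s ∷ []) v + val (map f ss′) v
    extract-val ss {s} {ss′} eq f v =
      trans (val-↭ (map⁺ f (proj₂ (extract-just ss eq))) v) (val-∷ (f s) (map f ss′) v)

  insert-val-≢ : ∀ E w M {v} → v ≢ w → v ∉ₗ E → val (cliquesOf E (insert w M)) v ≡ val (cliquesOf E M) v
  insert-val-≢ E w (ps , ss) {v} v≢w v∉E with extract w ss in eq
  ... | nothing = begin
    val (map (pairClique E) ps ++ singleClique E w ∷ map (singleClique E) ss) v
      ≡⟨ val-++ (map (pairClique E) ps) _ v ⟩
    P + val (singleClique E w ∷ map (singleClique E) ss) v
      ≡⟨ cong (P +_) (val-∷ (singleClique E w) _ v) ⟩
    P + (val (singleClique E w ∷ []) v + S)
      ≡⟨ cong (λ k → P + (k + S)) (val-none (singleClique E w ∷ []) λ { (here refl) → ∉-singleClique v≢w v∉E }) ⟩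
    P + S
      ≡⟨ sym (val-++ (map (pairClique E) ps) _ v) ⟩
    val (cliquesOf E (ps , ss)) v ∎
    where
    open ≡-Reasoning
    P = val (map (pairClique E) ps) v
    S = val (map (singleClique E) ss) v
  ... | just (s , ss′) = begin
    val (pairClique E (w , s) ∷ map (pairClique E) ps ++ map (singleClique E) ss′) v
      ≡⟨ val-∷ (pairClique E (w , s)) _ v ⟩
    val (pairClique E (w , s) ∷ []) v + val (map (pairClique E) ps ++ map (singleClique E) ss′) v
      ≡⟨ cong₂ _+_ (val-singleton-cong w,s⇒s s⇒w,s) (val-++ (map (pairClique E) ps) _ v) ⟩
    val (singleClique E s ∷ []) v + (P + S′)
      ≡⟨ x∙yz≈y∙xz _ P S′ ⟩
    P + (val (singleClique E s ∷ []) v + S′)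
      ≡⟨ cong (P +_) (sym (extract-val ss eq (singleClique E) v)) ⟩
    P + S
      ≡⟨ sym (val-++ (map (pairClique E) ps) _ v) ⟩
    val (cliquesOf E (ps , ss)) v ∎
    where
    open ≡-Reasoning
    P = val (map (pairClique E) ps) v
    S = val (map (singleClique E) ss) v
    S′ = val (map (singleClique E) ss′) v
    w,s⇒s : v ∈ pairClique E (w , s) → v ∈ singleClique E s
    w,s⇒s v∈ with ∈-fromList⁻ (w ∷ s ∷ E) v∈
    ... | here v≡w = ⊥-elim (v≢w v≡w)
    ... | there v∈s∷E = ∈-fromList⁺ (s ∷ E) v∈s∷E
    s⇒w,s : v ∈ singleClique E s → v ∈ pairClique E (w , s)
    s⇒w,s v∈ = ∈-fromList⁺ (w ∷ s ∷ E) (there (∈-fromList⁻ (s ∷ E) v∈))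

  insert-val-≡ : ∀ E w M → val (cliquesOf E (insert w M)) w ≤ suc (val (cliquesOf E M) w)
  insert-val-≡ E w (ps , ss) with extract w ss in eq
  ... | nothing = begin
    val (map (pairClique E) ps ++ singleClique E w ∷ map (singleClique E) ss) w
      ≡⟨ val-++ (map (pairClique E) ps) _ w ⟩
    P + val (singleClique E w ∷ map (singleClique E) ss) w
      ≡⟨ cong (P +_) (val-∷ (singleClique E w) _ w) ⟩
    P + (val (singleClique E w ∷ []) w + S)
      ≤⟨ +-monoʳ-≤ P (+-monoˡ-≤ S (val-singleton≤1 (singleClique E w) w)) ⟩
    P + suc S
      ≡⟨ +-suc P S ⟩
    suc (P + S)
      ≡⟨ cong suc (sym (val-++ (map (pairClique E) ps) _ w)) ⟩
    suc (val (cliquesOf E (ps , ss)) w) ∎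
    where
    open ≤-Reasoning
    P = val (map (pairClique E) ps) w
    S = val (map (singleClique E) ss) w
  ... | just (s , ss′) = begin
    val (pairClique E (w , s) ∷ map (pairClique E) ps ++ map (singleClique E) ss′) w
      ≡⟨ val-∷ (pairClique E (w , s)) _ w ⟩
    val (pairClique E (w , s) ∷ []) w + val (map (pairClique E) ps ++ map (singleClique E) ss′) w
      ≤⟨ +-mono-≤ (val-singleton≤1 (pairClique E (w , s)) w) (≤-reflexive (val-++ (map (pairClique E) ps) _ w)) ⟩
    suc (P + S′)
      ≤⟨ s≤s (+-monoʳ-≤ P (≤-trans (m≤n+m S′ _) (≤-reflexive (sym (extract-val ss eq (singleClique E) w))))) ⟩
    suc (P + S)
      ≡⟨ cong suc (sym (val-++ (map (pairClique E) ps) _ w)) ⟩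
    suc (val (cliquesOf E (ps , ss)) w) ∎
    where
    open ≤-Reasoning
    P = val (map (pairClique E) ps) w
    S = val (map (singleClique E) ss) w
    S′ = val (map (singleClique E) ss′) w

  matchCliques-val≤1 : ∀ E ws {v} → v ∉ₗ E → Unique ws → val (matchCliques E ws) v ≤ 1
  matchCliques-val≤1 E []       v∉E _                = z≤n
  matchCliques-val≤1 E (w ∷ ws) {v} v∉E (w∉ws ∷ unique) with v ≟ w
  ... | yes refl = ≤-trans (insert-val-≡ E w (match ws))
                           (s≤s (≤-reflexive (matchCliques-val-∉ E ws v∉E (λ w∈ → All.lookup w∉ws w∈ refl))))
  ... | no v≢w   =
    ≤-trans (≤-reflexive (insert-val-≢ E w (match ws) v≢w v∉E)) (matchCliques-val≤1 E ws v∉E unique)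

-- Independent neighbours and simplicial vertices

module _ {n : ℕ} (G : Graph n) where

  IndepNbrs : Fin n → List (Fin n) → Set
  IndepNbrs v L = All (Adj G v) L × AllPairs (Apart G) L

  AlphaAtLeast : Fin n → ℕ → Set
  AlphaAtLeast v s = ∃ λ L → IndepNbrs v L × s ≤ length L

  alphaAtLeast-⊔ : ∀ {v s t} → AlphaAtLeast v s → AlphaAtLeast v t → AlphaAtLeast v (s ⊔ t)
  alphaAtLeast-⊔ (L , indep , s≤) (L′ , indep′ , t≤) with ≤-total (length L) (length L′)
  ... | inj₁ L≤L′ = L′ , indep′ , ⊔-lub (≤-trans s≤ L≤L′) t≤
  ... | inj₂ L′≤L = L  , indep  , ⊔-lub s≤ (≤-trans t≤ L′≤L)

  indepNbrs-++ : ∀ {v L L′} → IndepNbrs v L → IndepNbrs v L′ → All (λ a → All (Apart G a) L′) L →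
                 IndepNbrs v (L ++ L′)
  indepNbrs-++ (adj , apart) (adj′ , apart′) cross = Allₚ.++⁺ adj adj′ , AllPairsₚ.++⁺ apart apart′ cross

  alphaAtLeast⇒≤α : ∀ {v s a} → AlphaAtLeast v s → IsAlpha G v a → s ≤ a
  alphaAtLeast⇒≤α {v} (L , (v~L , apart) , s≤L) (_ , maximal) =
    ≤-trans s≤L (≤-trans (length≤∣fromList∣ (AllPairs.map proj₁ apart)) (maximal (fromList L) independent))
    where
    independent : IsIndepInN G v (fromList L)
    independent = (λ u∈ → All.lookup v~L (∈-fromList⁻ L u∈)) , nonadjacent
      where
      nonadjacent : ∀ {u w} → u ∈ fromList L → w ∈ fromList L → ¬ Adj G u w
      nonadjacent {u} {w} u∈ w∈ u~w with u ≟ w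
      ... | yes refl = irrefl G u~w
      ... | no u≢w with allPairs-lookup apart (∈-fromList⁻ L u∈) (∈-fromList⁻ L w∈) u≢w
      ...   | inj₁ (_ , ¬u~w) = ¬u~w u~w
      ...   | inj₂ (_ , ¬w~u) = ¬w~u (adj-sym G u~w)

  NbrsAdjacent : Fin n → Fin n → Fin n → Set
  NbrsAdjacent v p q = Adj G v p → Adj G v q → p ≢ q → Adj G p q

  nbrsAdjacent? : ∀ v p q → Dec (NbrsAdjacent v p q)
  nbrsAdjacent? v p q = adj? G v p →-dec adj? G v q →-dec ¬? (p ≟ q) →-dec adj? G p q

  Simplicial : Fin n → Set
  Simplicial v = ∀ p q → NbrsAdjacent v p q

  simplicial? : Decidable Simplicial
  simplicial? v = all? λ p → all? (nbrsAdjacent? v p)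

  nonSimplicial⇒α≥2 : ∀ {v} → ¬ Simplicial v → AlphaAtLeast v 2
  nonSimplicial⇒α≥2 {v} ¬simplicial
    with p , ¬∀q ← ¬∀⟶∃¬ n _ (λ p → all? (nbrsAdjacent? v p)) ¬simplicial
    with q , ¬link ← ¬∀⟶∃¬ n _ (nbrsAdjacent? v p) ¬∀q
    with v~p , ¬link′ ← ¬→⇒×¬ (adj? G v p) ¬link
    with v~q , ¬link″ ← ¬→⇒×¬ (adj? G v q) ¬link′
    with p≢q , ¬p~q ← ¬→⇒×¬ (¬? (p ≟ q)) ¬link″
    = p ∷ q ∷ [] , (v~p ∷ v~q ∷ [] , ((p≢q , ¬p~q) ∷ []) ∷ [] ∷ []) , s≤s (s≤s z≤n)

  closedNbhd : Fin n → Subset n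
  closedNbhd v = subsetOf (λ u → u ≟ v ⊎-dec adj? G v u)

  ∈-closedNbhd⁺ : ∀ {v u} → u ≡ v ⊎ Adj G v u → u ∈ closedNbhd v
  ∈-closedNbhd⁺ {v} = ∈-subsetOf⁺ (λ u → u ≟ v ⊎-dec adj? G v u)

  ∈-closedNbhd⁻ : ∀ {v u} → u ∈ closedNbhd v → u ≡ v ⊎ Adj G v u
  ∈-closedNbhd⁻ {v} = ∈-subsetOf⁻ (λ u → u ≟ v ⊎-dec adj? G v u)

  closedNbhd-clique : ∀ {s} → Simplicial s → IsClique G (closedNbhd s)
  closedNbhd-clique {s} simplicial u∈ w∈ u≢w with ∈-closedNbhd⁻ u∈ | ∈-closedNbhd⁻ w∈
  ... | inj₁ refl | inj₁ refl = ⊥-elim (u≢w refl)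
  ... | inj₁ refl | inj₂ s~w  = s~w
  ... | inj₂ s~u  | inj₁ refl = adj-sym G s~u
  ... | inj₂ s~u  | inj₂ s~w  = simplicial _ _ s~u s~w u≢w

  closedNbhd-⊆ : ∀ {s t} → Simplicial s → Adj G s t → closedNbhd s ⊆ closedNbhd t
  closedNbhd-⊆ {s} {t} simplicial s~t {u} u∈ with ∈-closedNbhd⁻ u∈ | u ≟ t
  ... | inj₁ refl | _        = ∈-closedNbhd⁺ (inj₂ (adj-sym G s~t))
  ... | inj₂ _    | yes refl = ∈-closedNbhd⁺ (inj₁ refl)
  ... | inj₂ s~u  | no u≢t   = ∈-closedNbhd⁺ (inj₂ (simplicial t u s~t s~u (u≢t ∘ sym)))

  -- Each simplicial clique N[s] is listed once, under its least simplicial vertex.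
  Minimal : Fin n → Set
  Minimal c = ∀ t → Adj G c t → Simplicial t → c Fin.< t

  minimal? : Decidable Minimal
  minimal? c = all? λ t → adj? G c t →-dec simplicial? t →-dec c <? t

  simplicials : List (Fin n)
  simplicials = filter simplicial? (allFin n)

  leaders : List (Fin n)
  leaders = filter minimal? simplicials

  simplicialCliques : List (Subset n)
  simplicialCliques = map closedNbhd leaders

  ∈-leaders⁻ : ∀ {c} → c ∈ₗ leaders → Simplicial c × Minimal c
  ∈-leaders⁻ c∈ with c∈simplicials , minimal ← ∈-filter⁻ minimal? {xs = simplicials} c∈ =
    proj₂ (∈-filter⁻ simplicial? {xs = allFin n} c∈simplicials) , minimal

  leaders-nonadjacent : ∀ {c c′} → c ∈ₗ leaders → c′ ∈ₗ leaders → ¬ Adj G c c′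
  leaders-nonadjacent c∈ c′∈ c~c′ with ∈-leaders⁻ c∈ | ∈-leaders⁻ c′∈
  ... | simplicial , minimal | simplicial′ , minimal′ =
    <-asym (minimal _ c~c′ simplicial′) (minimal′ _ (adj-sym G c~c′) simplicial)

  leader-above : ∀ {s} → Simplicial s → ∃ λ c → c ∈ₗ leaders × closedNbhd s ⊆ closedNbhd c
  leader-above {s} = go s (Fin-<-wellFounded s)
    where
    go : ∀ s → Acc Fin._<_ s → Simplicial s → ∃ λ c → c ∈ₗ leaders × closedNbhd s ⊆ closedNbhd c
    go s (acc smaller) simplicial with minimal? s
    ... | yes minimal = s , ∈-filter⁺ minimal? (∈-filter⁺ simplicial? (∈-allFin s) simplicial) minimal , λ u∈ → u∈
    ... | no ¬minimal
      with t , ¬t-ok ← ¬∀⟶∃¬ n _ (λ t → adj? G s t →-dec simplicial? t →-dec s <? t) ¬minimal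
      with s~t , ¬t-ok′ ← ¬→⇒×¬ (adj? G s t) ¬t-ok
      with simplicial-t , s≮t ← ¬→⇒×¬ (simplicial? t) ¬t-ok′
      with c , c∈ , N[t]⊆N[c] ← go t (smaller (≢∧≮⇒> (λ { refl → irrefl G s~t }) s≮t)) simplicial-t
      = c , c∈ , N[t]⊆N[c] ∘ closedNbhd-⊆ simplicial s~t

  -- An edge au whose endpoints have a common simplicial neighbour s lies in the clique N[s]; the induction
  -- only has to cover the edges that a Needs.
  Share : Fin n → Fin n → Set
  Share a u = ∃ λ s → Simplicial s × Adj G s a × Adj G s u

  share? : ∀ a u → Dec (Share a u)
  share? a u = any? λ s → simplicial? s ×-dec adj? G s a ×-dec adj? G s u

  Needs : Fin n → Fin n → Set
  Needs a u = Adj G a u × ¬ Share a u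

  needs? : ∀ a u → Dec (Needs a u)
  needs? a u = adj? G a u ×-dec ¬? (share? a u)

  leadersAt : Fin n → List (Fin n)
  leadersAt a = filter (λ c → a ∈? closedNbhd c) leaders

  val-simplicialCliques : ∀ a → val simplicialCliques a ≡ length (leadersAt a)
  val-simplicialCliques = val-map closedNbhd leaders

  length-leadersAt : ∀ a → length (leadersAt a) ≤ length simplicials
  length-leadersAt a = ≤-trans (length-filter _ leaders) (length-filter minimal? simplicials)

  private
    ∈-leadersAt⁻ : ∀ {a c} → c ∈ₗ leadersAt a → c ∈ₗ leaders × (a ≡ c ⊎ Adj G c a)
    ∈-leadersAt⁻ {a} c∈ with c∈leaders , a∈N[c] ← ∈-filter⁻ (λ c → a ∈? closedNbhd c) {xs = leaders} c∈ =
      c∈leaders , ∈-closedNbhd⁻ a∈N[c]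

    unique-leadersAt : ∀ a → Unique (leadersAt a)
    unique-leadersAt a =
      Uniqueₚ.filter⁺ _ (Uniqueₚ.filter⁺ minimal? (Uniqueₚ.filter⁺ simplicial? (Uniqueₚ.allFin⁺ n)))

  leadersAt-adjacent : ∀ {a c} → ¬ Simplicial a → c ∈ₗ leadersAt a → Adj G c a
  leadersAt-adjacent ¬simplicial c∈ with ∈-leadersAt⁻ c∈
  ... | c∈leaders , inj₁ refl = ⊥-elim (¬simplicial (proj₁ (∈-leaders⁻ c∈leaders)))
  ... | _         , inj₂ c~a  = c~a

  leadersAt-indepNbrs : ∀ {a} → ¬ Simplicial a → IndepNbrs a (leadersAt a)
  leadersAt-indepNbrs {a} ¬simplicial =
    All.tabulate (adj-sym G ∘ leadersAt-adjacent ¬simplicial) ,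
    allPairs-strengthen
      (λ c∈ c′∈ c≢c′ → c≢c′ , leaders-nonadjacent (proj₁ (∈-leadersAt⁻ c∈)) (proj₁ (∈-leadersAt⁻ c′∈)))
      (unique-leadersAt a)

  leadersAt-alpha : ∀ {a} → ¬ Simplicial a → AlphaAtLeast a (length (leadersAt a))
  leadersAt-alpha ¬simplicial = leadersAt _ , leadersAt-indepNbrs ¬simplicial , ≤-refl

  leadersAt-apart : ∀ {a c u} → ¬ Simplicial a → ¬ Simplicial u → Needs a u → c ∈ₗ leadersAt a → Apart G c u
  leadersAt-apart ¬simplicial-a ¬simplicial-u (_ , ¬share) c∈ with proj₁ (∈-leadersAt⁻ c∈)
  ... | c∈leaders = (λ { refl → ¬simplicial-u simplicial-c }) ,
                    λ c~u → ¬share (_ , simplicial-c , leadersAt-adjacent ¬simplicial-a c∈ , c~u)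
    where simplicial-c = proj₁ (∈-leaders⁻ c∈leaders)

  leadersAt-simplicial≤1 : ∀ {s} → Simplicial s → length (leadersAt s) ≤ 1
  leadersAt-simplicial≤1 {s} simplicial = unique-constant⇒length≤1 (unique-leadersAt s) same
    where
    c∈N[s] : ∀ {c} → c ∈ₗ leadersAt s → c ∈ closedNbhd s
    c∈N[s] c∈ with proj₂ (∈-leadersAt⁻ c∈)
    ... | inj₁ refl = ∈-closedNbhd⁺ (inj₁ refl)
    ... | inj₂ c~s  = ∈-closedNbhd⁺ (inj₂ (adj-sym G c~s))
    same : ∀ {c c′} → c ∈ₗ leadersAt s → c′ ∈ₗ leadersAt s → c ≡ c′
    same {c} {c′} c∈ c′∈ with c ≟ c′
    ... | yes c≡c′ = c≡c′
    ... | no c≢c′  = ⊥-elim (leaders-nonadjacent (proj₁ (∈-leadersAt⁻ c∈)) (proj₁ (∈-leadersAt⁻ c′∈))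
                                (closedNbhd-clique simplicial (c∈N[s] c∈) (c∈N[s] c′∈) c≢c′))

-- Covering the non-simplicial vertices by induction

module _ {n : ℕ} (G : Graph n) where

  record Good (m k : ℕ) (v : Fin n) : Set where
    constructor good-at
    field
      s     : ℕ
      α≥s   : AlphaAtLeast G v s
      2≤s   : 2 ≤ s
      bound : ValencyBound m s k

  -- The simplicial vertices never enter W, but they are counted in the order.
  order : List (Fin n) → ℕ
  order W = length W + length (simplicials G)

  Covered : List (Subset n) → Fin n → Fin n → Set
  Covered 𝒞 u v = ∃ λ C → C ∈ₗ 𝒞 × u ∈ C × v ∈ C

  record Invariant (W : List (Fin n)) (𝒞 : List (Subset n)) : Set where
    field
      cliques : ∀ {C} → C ∈ₗ 𝒞 → IsClique G C
      inside  : ∀ {C u} → C ∈ₗ 𝒞 → u ∈ C → u ∈ₗ W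
      covers  : ∀ {u v} → u ∈ₗ W → v ∈ₗ W → Adj G u v → ¬ Share G u v → Covered 𝒞 u v
      good    : ∀ {v} → v ∈ₗ W → Good (order W) (val (simplicialCliques G) v + val 𝒞 v) v

  open Invariant

  invariant-[] : Invariant [] []
  invariant-[] = record { cliques = λ () ; inside = λ () ; covers = λ () ; good = λ () }

  invariant-↭ : ∀ {W W′ 𝒞} → W ↭ W′ → Invariant W 𝒞 → Invariant W′ 𝒞
  invariant-↭ {W} {W′} {𝒞} W↭W′ inv = record
    { cliques = cliques inv
    ; inside  = λ C∈ u∈ → ∈-resp-↭ W↭W′ (inside inv C∈ u∈)
    ; covers  = λ u∈ v∈ → covers inv (∈-resp-↭ (↭-sym W↭W′) u∈) (∈-resp-↭ (↭-sym W↭W′) v∈)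
    ; good    = λ {v} v∈ → subst (λ m → Good m (val (simplicialCliques G) v + val 𝒞 v) v)
                                 (cong (_+ length (simplicials G)) (↭-length W↭W′))
                                 (good inv (∈-resp-↭ (↭-sym W↭W′) v∈))
    }

  good-mono-order : ∀ {m m′ k v} → m ≤ m′ → Good m k v → Good m′ k v
  good-mono-order {k = k} m≤m′ (good-at s α≥s 2≤s bound) =
    good-at s α≥s 2≤s (bound-mono-order {k = k} (≤-trans (s≤s z≤n) 2≤s) m≤m′ bound)

  good-suc : ∀ {m k k′ v} → k′ ≤ suc k → Good m k v → Good (2 + m) k′ v
  good-suc {k = k} k′≤1+k (good-at s α≥s 2≤s bound) =
    good-at s α≥s 2≤s (bound-antimono-val k′≤1+k (bound-suc {k = k} 2≤s bound))

  invariant-isolated : ∀ {x W 𝒞} → x ∉ₗ W → ¬ Simplicial G x → All (¬_ ∘ Adj G x) W →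
                       Invariant W 𝒞 → Invariant (x ∷ W) 𝒞
  invariant-isolated {x} {W} {𝒞} x∉W ¬simplicial x≁W inv = record
    { cliques = cliques inv
    ; inside  = λ C∈ u∈ → there (inside inv C∈ u∈)
    ; covers  = covers′
    ; good    = λ { (here refl) → good-x ; (there v∈) → good-mono-order (n≤1+n _) (good inv v∈) }
    }
    where
    covers′ : ∀ {u v} → u ∈ₗ x ∷ W → v ∈ₗ x ∷ W → Adj G u v → ¬ Share G u v → Covered 𝒞 u v
    covers′ (here refl) (here refl) x~x _ = ⊥-elim (irrefl G x~x)
    covers′ (here refl) (there v∈)  x~v _ = ⊥-elim (All.lookup x≁W v∈ x~v)
    covers′ (there u∈)  (here refl) u~x _ = ⊥-elim (All.lookup x≁W u∈ (adj-sym G u~x))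
    covers′ (there u∈)  (there v∈)  u~v ¬share = covers inv u∈ v∈ u~v ¬share
    k = length (leadersAt G x)
    good-x : Good (order (x ∷ W)) (val (simplicialCliques G) x + val 𝒞 x) x
    good-x = subst (λ k′ → Good (order (x ∷ W)) k′ x)
               (sym (trans (cong₂ _+_ (val-simplicialCliques G x) (val-none 𝒞 (λ C∈ x∈ → x∉W (inside inv C∈ x∈))))
                           (+-identityʳ k)))
               (good-at (k ⊔ 2) (alphaAtLeast-⊔ G (leadersAt-alpha G ¬simplicial) (nonSimplicial⇒α≥2 G ¬simplicial))
                  (m≤n⊔m k 2) (bound-isolated (m≤n⊔m k 2) (m≤m⊔n k 2)
                                              (s≤s (≤-trans (length-leadersAt G x) (m≤n+m _ (length W))))))

  alpha-leadersAt++singles : ∀ {a} g → ¬ Simplicial G a → Unique g →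
                             (∀ {u} → u ∈ₗ g → Needs G a u × ¬ Simplicial G u) →
                             AlphaAtLeast G a (length (leadersAt G a) + length (singles G (match G g)))
  alpha-leadersAt++singles {a} g ¬simplicial unique needs-g =
    leadersAt G a ++ ss ,
    indepNbrs-++ G (leadersAt-indepNbrs G ¬simplicial)
      (All.tabulate (λ u∈ → proj₁ (proj₁ (needs-g (in-g u∈)))) , match-singles-apart G g unique)
      (All.tabulate λ c∈ → All.tabulate λ u∈ →
        leadersAt-apart G ¬simplicial (proj₂ (needs-g (in-g u∈))) (proj₁ (needs-g (in-g u∈))) c∈) ,
    ≤-reflexive (sym (length-++ (leadersAt G a)))
    where
    ss = singles G (match G g)
    in-g : ∀ {u} → u ∈ₗ ss → u ∈ₗ g
    in-g = All.lookup (proj₂ (match-sound G g))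

  endpoint-good : ∀ {a m c} g₁ g₂ → ¬ Simplicial G a → Unique g₁ → Unique g₂ →
                  (∀ {u} → u ∈ₗ g₁ ++ g₂ → Needs G a u × ¬ Simplicial G u) →
                  2 + length (leadersAt G a) + (length g₁ + length g₂) ≤ m →
                  (g₁ ≡ [] × c ≡ 1) ⊎ c ≡ partCount G g₁ →
                  Good m (length (leadersAt G a) + (c + partCount G g₂)) a
  endpoint-good {a} {m} g₁ g₂ ¬simplicial unique₁ unique₂ needs m₀≤m count =
    good-at s (alphaAtLeast-⊔ G (alphaAtLeast-⊔ G (alpha-leadersAt++singles g₁ ¬simplicial unique₁ (needs ∘ ∈-++⁺ˡ))
                                                  (alpha-leadersAt++singles g₂ ¬simplicial unique₂ (needs ∘ ∈-++⁺ʳ g₁)))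
                                 (nonSimplicial⇒α≥2 G ¬simplicial))
              2≤s (bound count)
    where
    k  = length (leadersAt G a)
    p₁ = length (pairs G (match G g₁))
    u₁ = length (singles G (match G g₁))
    p₂ = length (pairs G (match G g₂))
    u₂ = length (singles G (match G g₂))
    s  = (k + u₁) ⊔ (k + u₂) ⊔ 2
    2≤s : 2 ≤ s
    2≤s = m≤n⊔m _ 2
    k+u₁≤s : k + u₁ ≤ s
    k+u₁≤s = ≤-trans (m≤m⊔n (k + u₁) (k + u₂)) (m≤m⊔n _ 2)
    k+u₂≤s : k + u₂ ≤ s
    k+u₂≤s = ≤-trans (m≤n⊔m (k + u₁) (k + u₂)) (m≤m⊔n _ 2)
    sizes : 2 + k + ((2 * p₁ + u₁) + (2 * p₂ + u₂)) ≤ m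
    sizes = subst (λ l → 2 + k + l ≤ m) (sym (cong₂ _+_ (match-size G g₁) (match-size G g₂))) m₀≤m
    bound : ∀ {c} → (g₁ ≡ [] × c ≡ 1) ⊎ c ≡ partCount G g₁ → ValencyBound m s (k + (c + partCount G g₂))
    bound (inj₁ (refl , refl)) = bound-endpoint-edge {k = k} {p = p₂} {u = u₂} 2≤s k+u₂≤s sizes
    bound (inj₂ refl)          =
      bound-endpoint {k = k} {p₁ = p₁} {u₁ = u₁} {p₂ = p₂} {u₂ = u₂} 2≤s k+u₁≤s k+u₂≤s sizes

  module EdgeStep (x y : Fin n) (W : List (Fin n)) where

    inCommon? : ∀ u → Dec (Needs G x u × Needs G y u)
    inCommon? u = needs? G x u ×-dec needs? G y u

    inOnly? : ∀ a b u → Dec (Needs G a u × ¬ Needs G b u)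
    inOnly? a b u = needs? G a u ×-dec ¬? (needs? G b u)

    common : List (Fin n)
    common = filter inCommon? W

    only : Fin n → Fin n → List (Fin n)
    only a b = filter (inOnly? a b) W

    -- The cliques of a nonempty common group contain x and y, so xy needs a clique of its own only when
    -- that group is empty.
    edgeCliques : List (Fin n) → List (Subset n)
    edgeCliques []       = fromList (x ∷ y ∷ []) ∷ []
    edgeCliques (u ∷ us) = matchCliques G (x ∷ y ∷ []) (u ∷ us)

    onlyCliques : Fin n → Fin n → List (Subset n)
    onlyCliques a b = matchCliques G (a ∷ []) (only a b)

    newCliques : List (Subset n)
    newCliques = edgeCliques common ++ onlyCliques x y ++ onlyCliques y x

    ∈-common⁻ : ∀ {u} → u ∈ₗ common → u ∈ₗ W × Needs G x u × Needs G y u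
    ∈-common⁻ u∈ with u∈W , needs-x , needs-y ← ∈-filter⁻ inCommon? {xs = W} u∈ =
      u∈W , needs-x , needs-y

    ∈-only⁻ : ∀ {a b u} → u ∈ₗ only a b → u ∈ₗ W × Needs G a u × ¬ Needs G b u
    ∈-only⁻ {a} {b} u∈ with u∈W , needs-a , ¬needs-b ← ∈-filter⁻ (inOnly? a b) {xs = W} u∈ =
      u∈W , needs-a , ¬needs-b

    edgeCliques-⊆ : ∀ g {C u} → C ∈ₗ edgeCliques g → u ∈ C → u ∈ₗ g ⊎ u ∈ₗ x ∷ y ∷ []
    edgeCliques-⊆ []       (here refl) u∈ = inj₂ (∈-fromList⁻ (x ∷ y ∷ []) u∈)
    edgeCliques-⊆ (v ∷ vs) C∈          u∈ = matchCliques-⊆ G (x ∷ y ∷ []) (v ∷ vs) C∈ u∈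

    xy-clique : Adj G x y → IsCliqueList G (x ∷ y ∷ [])
    xy-clique x~y = cliqueList-∷ G (λ { (here refl) → x~y ; (there ()) }) (cliqueList-∷ G (λ ()) (λ ()))

    edgeCliques-clique : Adj G x y → ∀ g → (∀ {u} → u ∈ₗ g → Adj G x u × Adj G y u) →
                         ∀ {C} → C ∈ₗ edgeCliques g → IsClique G C
    edgeCliques-clique x~y []       _    (here refl) = fromList-clique G (x ∷ y ∷ []) (xy-clique x~y)
    edgeCliques-clique x~y (v ∷ vs) g~xy C∈ = matchCliques-clique G (x ∷ y ∷ []) (v ∷ vs) g~E (xy-clique x~y) C∈
      where
      g~E : ∀ {a e} → a ∈ₗ v ∷ vs → e ∈ₗ x ∷ y ∷ [] → Adj G a e
      g~E a∈ (here refl)         = adj-sym G (proj₁ (g~xy a∈))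
      g~E a∈ (there (here refl)) = adj-sym G (proj₂ (g~xy a∈))

    edgeCliques-covers-xy : ∀ g → Covered (edgeCliques g) x y
    edgeCliques-covers-xy [] =
      _ , here refl , ∈-fromList⁺ (x ∷ y ∷ []) (here refl) , ∈-fromList⁺ (x ∷ y ∷ []) (there (here refl))
    edgeCliques-covers-xy (v ∷ vs) with matchCliques-covers G (x ∷ y ∷ []) (v ∷ vs) (here refl)
    ... | C , C∈ , _ , E⊆C = C , C∈ , E⊆C (here refl) , E⊆C (there (here refl))

    edgeCliques-covers : ∀ g {w} → w ∈ₗ g → ∃ λ C → C ∈ₗ edgeCliques g × w ∈ C × x ∈ C × y ∈ C
    edgeCliques-covers []       ()
    edgeCliques-covers (v ∷ vs) w∈ with matchCliques-covers G (x ∷ y ∷ []) (v ∷ vs) w∈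
    ... | C , C∈ , w∈C , E⊆C = C , C∈ , w∈C , E⊆C (here refl) , E⊆C (there (here refl))

    edgeCliques-val-end : ∀ g {e} → e ∈ₗ x ∷ y ∷ [] →
                          (g ≡ [] × val (edgeCliques g) e ≡ 1) ⊎ val (edgeCliques g) e ≡ partCount G g
    edgeCliques-val-end []       e∈ =
      inj₁ (refl , val-all (edgeCliques []) (λ { (here refl) → ∈-fromList⁺ (x ∷ y ∷ []) e∈ }))
    edgeCliques-val-end (v ∷ vs) e∈ = inj₂ (matchCliques-val-∈ G (x ∷ y ∷ []) (v ∷ vs) e∈)

    edgeCliques-val≤1 : ∀ g {v} → v ∉ₗ x ∷ y ∷ [] → Unique g → val (edgeCliques g) v ≤ 1
    edgeCliques-val≤1 []       {v} _   _      = val-singleton≤1 (fromList (x ∷ y ∷ [])) v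
    edgeCliques-val≤1 (u ∷ us)     v∉E unique = matchCliques-val≤1 G (x ∷ y ∷ []) (u ∷ us) v∉E unique

    edgeCliques-val-∉ : ∀ g {v} → v ∉ₗ x ∷ y ∷ [] → v ∉ₗ g → val (edgeCliques g) v ≡ 0
    edgeCliques-val-∉ []       v∉E _   =
      val-none (edgeCliques []) (λ { (here refl) v∈ → v∉E (∈-fromList⁻ (x ∷ y ∷ []) v∈) })
    edgeCliques-val-∉ (u ∷ us) v∉E v∉g = matchCliques-val-∉ G (x ∷ y ∷ []) (u ∷ us) v∉E v∉g

    onlyCliques-⊆ : ∀ a b {C u} → C ∈ₗ onlyCliques a b → u ∈ C → u ∈ₗ W ⊎ u ≡ a
    onlyCliques-⊆ a b C∈ u∈ with matchCliques-⊆ G (a ∷ []) (only a b) C∈ u∈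
    ... | inj₁ u∈g        = inj₁ (proj₁ (∈-only⁻ u∈g))
    ... | inj₂ (here u≡a) = inj₂ u≡a

    onlyCliques-clique : ∀ a b {C} → C ∈ₗ onlyCliques a b → IsClique G C
    onlyCliques-clique a b = matchCliques-clique G (a ∷ []) (only a b)
      (λ { u∈ (here refl) → adj-sym G (proj₁ (proj₁ (proj₂ (∈-only⁻ u∈)))) }) (cliqueList-∷ G (λ ()) (λ ()))

    module _ {𝒞 : List (Subset n)} (unique : Unique (x ∷ y ∷ W))
             (nonSimplicial : All (¬_ ∘ Simplicial G) (x ∷ y ∷ W)) (x~y : Adj G x y) (inv : Invariant W 𝒞) where

      private
        x∉W : x ∉ₗ W
        x∉W x∈ = All.lookup (All.tail (AllPairs.head unique)) x∈ refl

        y∉W : y ∉ₗ W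
        y∉W y∈ = All.lookup (AllPairs.head (AllPairs.tail unique)) y∈ refl

        unique-filter : ∀ {p} {P : Pred (Fin n) p} (P? : Decidable P) → Unique (filter P? W)
        unique-filter P? = Uniqueₚ.filter⁺ P? (AllPairs.tail (AllPairs.tail unique))

        ¬simplicial-W : ∀ {u} → u ∈ₗ W → ¬ Simplicial G u
        ¬simplicial-W = All.lookup (All.tail (All.tail nonSimplicial))

        W∌x,y : ∀ {v} → v ∈ₗ W → v ∉ₗ x ∷ y ∷ []
        W∌x,y v∈ (here refl)         = x∉W v∈
        W∌x,y v∈ (there (here refl)) = y∉W v∈

        W∌x : ∀ {v} → v ∈ₗ W → v ∉ₗ x ∷ []
        W∌x v∈ (here refl) = x∉W v∈

        W∌y : ∀ {v} → v ∈ₗ W → v ∉ₗ y ∷ []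
        W∌y v∈ (here refl) = y∉W v∈

        x,y⊆ : ∀ {u} → u ∈ₗ x ∷ y ∷ [] → u ∈ₗ x ∷ y ∷ W
        x,y⊆ (here refl)         = here refl
        x,y⊆ (there (here refl)) = there (here refl)

      newCliques-⊆ : ∀ {C u} → C ∈ₗ newCliques → u ∈ C → u ∈ₗ x ∷ y ∷ W
      newCliques-⊆ C∈ u∈ with ∈-++⁻ (edgeCliques common) C∈
      ... | inj₁ C∈e = [ there ∘ there ∘ proj₁ ∘ ∈-common⁻ , x,y⊆ ]′ (edgeCliques-⊆ common C∈e u∈)
      ... | inj₂ C∈r with ∈-++⁻ (onlyCliques x y) C∈r
      ...   | inj₁ C∈x = [ there ∘ there , (λ { refl → here refl }) ]′ (onlyCliques-⊆ x y C∈x u∈)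
      ...   | inj₂ C∈y = [ there ∘ there , (λ { refl → there (here refl) }) ]′ (onlyCliques-⊆ y x C∈y u∈)

      newCliques-clique : ∀ {C} → C ∈ₗ newCliques → IsClique G C
      newCliques-clique C∈ with ∈-++⁻ (edgeCliques common) C∈
      ... | inj₁ C∈e = edgeCliques-clique x~y common
                         (λ u∈ → let _ , (x~u , _) , (y~u , _) = ∈-common⁻ u∈ in x~u , y~u) C∈e
      ... | inj₂ C∈r = [ onlyCliques-clique x y , onlyCliques-clique y x ]′ (∈-++⁻ (onlyCliques x y) C∈r)

      private
        x∉onlyYX : x ∉ₗ only y x
        x∉onlyYX x∈ = x∉W (proj₁ (∈-only⁻ x∈))

        y∉onlyXY : y ∉ₗ only x y
        y∉onlyXY y∈ = y∉W (proj₁ (∈-only⁻ y∈))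

        x≢y : x ≢ y
        x≢y refl = irrefl G x~y

        val-newCliques : ∀ v → val newCliques v ≡
                               val (edgeCliques common) v + (val (onlyCliques x y) v + val (onlyCliques y x) v)
        val-newCliques v = trans (val-++ (edgeCliques common) _ v)
                                 (cong (val (edgeCliques common) v +_) (val-++ (onlyCliques x y) _ v))

      val-newCliques-x : val newCliques x ≡ val (edgeCliques common) x + partCount G (only x y)
      val-newCliques-x = trans (val-newCliques x)
        (cong (val (edgeCliques common) x +_)
          (trans (cong₂ _+_ (matchCliques-val-∈ G (x ∷ []) (only x y) (here refl))
                            (matchCliques-val-∉ G (y ∷ []) (only y x) (λ { (here x≡y) → x≢y x≡y }) x∉onlyYX))
                 (+-identityʳ _)))

      val-newCliques-y : val newCliques y ≡ val (edgeCliques common) y + partCount G (only y x)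
      val-newCliques-y = trans (val-newCliques y)
        (cong (val (edgeCliques common) y +_)
          (cong₂ _+_ (matchCliques-val-∉ G (x ∷ []) (only x y) (λ { (here y≡x) → x≢y (sym y≡x) }) y∉onlyXY)
                     (matchCliques-val-∈ G (y ∷ []) (only y x) (here refl))))

      private
        val-common≡0 : ∀ {v} → v ∈ₗ W → ¬ (Needs G x v × Needs G y v) → val (edgeCliques common) v ≡ 0
        val-common≡0 v∈ ¬needs = edgeCliques-val-∉ common (W∌x,y v∈) (λ v∈′ → ¬needs (proj₂ (∈-common⁻ v∈′)))

        val-only≡0 : ∀ {a b v} → v ∉ₗ a ∷ [] → ¬ (Needs G a v × ¬ Needs G b v) → val (onlyCliques a b) v ≡ 0
        val-only≡0 {a} {b} v∉a ¬only =
          matchCliques-val-∉ G (a ∷ []) (only a b) v∉a (λ v∈′ → ¬only (proj₂ (∈-only⁻ v∈′)))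

        val-only≤1 : ∀ {a b v} → v ∉ₗ a ∷ [] → val (onlyCliques a b) v ≤ 1
        val-only≤1 {a} {b} v∉a = matchCliques-val≤1 G (a ∷ []) (only a b) v∉a (unique-filter _)

      val-newCliques-W : ∀ {v} → v ∈ₗ W → val newCliques v ≤ 1
      val-newCliques-W {v} v∈ rewrite val-newCliques v with needs? G x v | needs? G y v
      ... | yes needs-x | yes needs-y = one-of-three (inj₁
        ( edgeCliques-val≤1 common (W∌x,y v∈) (unique-filter _)
        , val-only≡0 (W∌x v∈) (λ (_ , ¬needs-y) → ¬needs-y needs-y)
        , val-only≡0 (W∌y v∈) (λ (_ , ¬needs-x) → ¬needs-x needs-x) ))
      ... | yes _ | no ¬needs-y = one-of-three (inj₂ (inj₁
        (val-common≡0 v∈ (¬needs-y ∘ proj₂) , val-only≤1 (W∌x v∈) , val-only≡0 (W∌y v∈) (¬needs-y ∘ proj₁))))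
      ... | no ¬needs-x | _ = one-of-three (inj₂ (inj₂
        (val-common≡0 v∈ (¬needs-x ∘ proj₁) , val-only≡0 (W∌x v∈) (¬needs-x ∘ proj₁) , val-only≤1 (W∌y v∈))))

      private
        covered-x : ∀ {v} → v ∈ₗ W → Needs G x v → Covered (newCliques ++ 𝒞) x v
        covered-x {v} v∈ needs-x with needs? G y v
        ... | yes needs-y
          with C , C∈ , v∈C , x∈C , _ ← edgeCliques-covers common (∈-filter⁺ _ v∈ (needs-x , needs-y)) =
          C , ∈-++⁺ˡ (∈-++⁺ˡ C∈) , x∈C , v∈C
        covered-x {v} v∈ needs-x | no ¬needs-y
          with C , C∈ , v∈C , E⊆C ← matchCliques-covers G (x ∷ []) (only x y)
                                                      (∈-filter⁺ _ v∈ (needs-x , ¬needs-y)) =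
          C , ∈-++⁺ˡ (∈-++⁺ʳ (edgeCliques common) (∈-++⁺ˡ C∈)) , E⊆C (here refl) , v∈C

        covered-y : ∀ {v} → v ∈ₗ W → Needs G y v → Covered (newCliques ++ 𝒞) y v
        covered-y {v} v∈ needs-y with needs? G x v
        ... | yes needs-x
          with C , C∈ , v∈C , _ , y∈C ← edgeCliques-covers common (∈-filter⁺ _ v∈ (needs-x , needs-y)) =
          C , ∈-++⁺ˡ (∈-++⁺ˡ C∈) , y∈C , v∈C
        covered-y {v} v∈ needs-y | no ¬needs-x
          with C , C∈ , v∈C , E⊆C ← matchCliques-covers G (y ∷ []) (only y x)
                                                      (∈-filter⁺ _ v∈ (needs-y , ¬needs-x)) =
          C , ∈-++⁺ˡ (∈-++⁺ʳ (edgeCliques common) (∈-++⁺ʳ (onlyCliques x y) C∈)) , E⊆C (here refl) , v∈C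

        covered-sym : ∀ {𝒟 u v} → Covered 𝒟 u v → Covered 𝒟 v u
        covered-sym (C , C∈ , u∈ , v∈) = C , C∈ , v∈ , u∈

        share-sym : ∀ {u v} → Share G u v → Share G v u
        share-sym (s , simplicial , s~u , s~v) = s , simplicial , s~v , s~u

      covers-new : ∀ {u v} → u ∈ₗ x ∷ y ∷ W → v ∈ₗ x ∷ y ∷ W → Adj G u v → ¬ Share G u v →
                   Covered (newCliques ++ 𝒞) u v
      covers-new (here refl)         (here refl)         u~v _ = ⊥-elim (irrefl G u~v)
      covers-new (there (here refl)) (there (here refl)) u~v _ = ⊥-elim (irrefl G u~v)
      covers-new (here refl)         (there (here refl)) _   _ =
        let C , C∈ , x∈ , y∈ = edgeCliques-covers-xy common in C , ∈-++⁺ˡ (∈-++⁺ˡ C∈) , x∈ , y∈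
      covers-new (there (here refl)) (here refl)         _   _ =
        let C , C∈ , x∈ , y∈ = edgeCliques-covers-xy common in C , ∈-++⁺ˡ (∈-++⁺ˡ C∈) , y∈ , x∈
      covers-new (here refl)         (there (there v∈))  x~v ¬share = covered-x v∈ (x~v , ¬share)
      covers-new (there (there u∈))  (here refl)         u~x ¬share =
        covered-sym (covered-x u∈ (adj-sym G u~x , ¬share ∘ share-sym))
      covers-new (there (here refl)) (there (there v∈))  y~v ¬share = covered-y v∈ (y~v , ¬share)
      covers-new (there (there u∈))  (there (here refl)) u~y ¬share =
        covered-sym (covered-y u∈ (adj-sym G u~y , ¬share ∘ share-sym))
      covers-new (there (there u∈))  (there (there v∈))  u~v ¬share =
        let C , C∈ , u∈C , v∈C = covers inv u∈ v∈ u~v ¬share in C , ∈-++⁺ʳ newCliques C∈ , u∈C , v∈C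

      private
        val-endpoint : ∀ {a} → a ∉ₗ W →
                       val (simplicialCliques G) a + val (newCliques ++ 𝒞) a ≡
                       length (leadersAt G a) + val newCliques a
        val-endpoint {a} a∉W = cong₂ _+_ (val-simplicialCliques G a)
          (trans (val-++ newCliques 𝒞 a)
                 (trans (cong (val newCliques a +_) (val-none 𝒞 (λ C∈ a∈ → a∉W (inside inv C∈ a∈)))) (+-identityʳ _)))

        order-bound : ∀ a (g₁ g₂ : List (Fin n)) → length g₁ + length g₂ ≤ length W →
                      2 + length (leadersAt G a) + (length g₁ + length g₂) ≤ order (x ∷ y ∷ W)
        order-bound a _ _ g≤W =
          s≤s (s≤s (≤-trans (≤-reflexive (+-comm (length (leadersAt G a)) _))
                            (+-mono-≤ g≤W (length-leadersAt G a))))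

        needs-groups : ∀ {a b u} → u ∈ₗ common ++ only a b → (u ∈ₗ common → Needs G a u) →
                       Needs G a u × ¬ Simplicial G u
        needs-groups {a} {b} u∈ common⇒needs with ∈-++⁻ common u∈
        ... | inj₁ u∈c = common⇒needs u∈c , ¬simplicial-W (proj₁ (∈-common⁻ u∈c))
        ... | inj₂ u∈o = proj₁ (proj₂ (∈-only⁻ u∈o)) , ¬simplicial-W (proj₁ (∈-only⁻ u∈o))

      good-x : Good (order (x ∷ y ∷ W)) (val (simplicialCliques G) x + val (newCliques ++ 𝒞) x) x
      good-x = subst (λ k → Good (order (x ∷ y ∷ W)) k x)
        (sym (trans (val-endpoint x∉W) (cong (length (leadersAt G x) +_) val-newCliques-x)))
        (endpoint-good common (only x y) (All.head nonSimplicial) (unique-filter _) (unique-filter _)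
           (λ u∈ → needs-groups u∈ (proj₁ ∘ proj₂ ∘ ∈-common⁻))
           (order-bound x common (only x y)
              (length-filter-disjoint inCommon? (inOnly? x y) (λ (_ , needs-y) (_ , ¬needs-y) → ¬needs-y needs-y) W))
           (edgeCliques-val-end common (here refl)))

      good-y : Good (order (x ∷ y ∷ W)) (val (simplicialCliques G) y + val (newCliques ++ 𝒞) y) y
      good-y = subst (λ k → Good (order (x ∷ y ∷ W)) k y)
        (sym (trans (val-endpoint y∉W) (cong (length (leadersAt G y) +_) val-newCliques-y)))
        (endpoint-good common (only y x) (All.head (All.tail nonSimplicial)) (unique-filter _) (unique-filter _)
           (λ u∈ → needs-groups u∈ (proj₂ ∘ proj₂ ∘ ∈-common⁻))
           (order-bound y common (only y x)
              (length-filter-disjoint inCommon? (inOnly? y x) (λ (needs-x , _) (_ , ¬needs-x) → ¬needs-x needs-x) W))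
           (edgeCliques-val-end common (there (here refl))))

      good-new : ∀ {v} → v ∈ₗ x ∷ y ∷ W →
                 Good (order (x ∷ y ∷ W)) (val (simplicialCliques G) v + val (newCliques ++ 𝒞) v) v
      good-new (here refl)         = good-x
      good-new (there (here refl)) = good-y
      good-new {v} (there (there v∈)) = good-suc (begin
        K + val (newCliques ++ 𝒞) v  ≡⟨ cong (K +_) (val-++ newCliques 𝒞 v) ⟩
        K + (val newCliques v + C)   ≤⟨ +-monoʳ-≤ K (+-monoˡ-≤ C (val-newCliques-W v∈)) ⟩
        K + suc C                    ≡⟨ +-suc K C ⟩
        suc (K + C)                  ∎) (good inv v∈)
        where
        open ≤-Reasoning
        K = val (simplicialCliques G) v
        C = val 𝒞 v

      invariant-edge : Invariant (x ∷ y ∷ W) (newCliques ++ 𝒞)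
      invariant-edge = record
        { cliques = λ C∈ → [ newCliques-clique , cliques inv ]′ (∈-++⁻ newCliques C∈)
        ; inside  = λ C∈ u∈ → [ (λ C∈new → newCliques-⊆ C∈new u∈)
                              , (λ C∈old → there (there (inside inv C∈old u∈))) ]′ (∈-++⁻ newCliques C∈)
        ; covers  = covers-new
        ; good    = good-new
        }

  buildCover : ∀ W → Acc _<_ (length W) → Unique W → All (¬_ ∘ Simplicial G) W → ∃ (Invariant W)
  buildCover []       _            _                   _                         = [] , invariant-[]
  buildCover (x ∷ W₀) (acc smaller) unique nonSimplicial with Any.any? (adj? G x) W₀
  ... | no ¬x~W₀ =
    let 𝒞 , inv = buildCover W₀ (smaller ≤-refl) (AllPairs.tail unique) (All.tail nonSimplicial) in
    𝒞 , invariant-isolated (Unique[x∷xs]⇒x∉xs unique) (All.head nonSimplicial) (¬Any⇒All¬ W₀ ¬x~W₀) inv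
  ... | yes x~W₀
    with y , y∈W₀ , x~y ← find x~W₀
    with ys , zs , refl ← ∈-∃++ y∈W₀ =
    let 𝒞 , inv = buildCover (ys ++ zs) (smaller shorter) (AllPairs.tail (AllPairs.tail unique′))
                        (All.tail (All.tail nonSimplicial′)) in
    EdgeStep.newCliques x y (ys ++ zs) ++ 𝒞 ,
    invariant-↭ (↭-sym reorder) (EdgeStep.invariant-edge x y (ys ++ zs) unique′ nonSimplicial′ x~y inv)
    where
    reorder : x ∷ ys ++ y ∷ zs ↭ x ∷ y ∷ ys ++ zs
    reorder = ↭-prep x (shift y ys zs)
    unique′ : Unique (x ∷ y ∷ ys ++ zs)
    unique′ = PermutationSetoid.Unique-resp-↭ (setoid (Fin n)) (↭⇒↭ₛ reorder) unique
    nonSimplicial′ : All (¬_ ∘ Simplicial G) (x ∷ y ∷ ys ++ zs)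
    nonSimplicial′ = All.tabulate (All.lookup nonSimplicial ∘ ∈-resp-↭ (↭-sym reorder))
    shorter : length (ys ++ zs) < length (x ∷ ys ++ y ∷ zs)
    shorter = s≤s (≤-trans (n≤1+n _) (≤-reflexive (sym (length-++-sucʳ ys y zs))))

-- The cover

module _ {n : ℕ} (G : Graph n) where

  nonSimplicials : List (Fin n)
  nonSimplicials = filter (¬? ∘ simplicial? G) (allFin n)

  private
    ∈-nonSimplicials : ∀ {v} → ¬ Simplicial G v → v ∈ₗ nonSimplicials
    ∈-nonSimplicials = ∈-filter⁺ (¬? ∘ simplicial? G) (∈-allFin _)

    core : ∃ (Invariant G nonSimplicials)
    core = buildCover G nonSimplicials (<-wellFounded _) (Uniqueₚ.filter⁺ _ (Uniqueₚ.allFin⁺ n))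
                      (All.tabulate (proj₂ ∘ ∈-filter⁻ (¬? ∘ simplicial? G) {xs = allFin n}))

    open Invariant (proj₂ core)

  cover : List (Subset n)
  cover = simplicialCliques G ++ proj₁ core

  cover-cliques : ∀ {C} → C ∈ₗ cover → IsClique G C
  cover-cliques C∈ with ∈-++⁻ (simplicialCliques G) C∈
  ... | inj₁ C∈K with c , c∈ , refl ← ∈-map⁻ (closedNbhd G) C∈K = closedNbhd-clique G (proj₁ (∈-leaders⁻ G c∈))
  ... | inj₂ C∈𝒞 = cliques C∈𝒞

  private
    covered-by-simplicial : ∀ {s u v} → Simplicial G s → u ∈ closedNbhd G s → v ∈ closedNbhd G s →
                            Covered G cover u v
    covered-by-simplicial simplicial u∈ v∈ with c , c∈ , N[s]⊆N[c] ← leader-above G simplicial =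
      closedNbhd G c , ∈-++⁺ˡ (∈-map⁺ (closedNbhd G) c∈) , N[s]⊆N[c] u∈ , N[s]⊆N[c] v∈

  cover-covers : ∀ {u v} → Adj G u v → Covered G cover u v
  cover-covers {u} {v} u~v with simplicial? G u | simplicial? G v | share? G u v
  ... | yes simplicial | _ | _ =
    covered-by-simplicial simplicial (∈-closedNbhd⁺ G (inj₁ refl)) (∈-closedNbhd⁺ G (inj₂ u~v))
  ... | no _ | yes simplicial | _ =
    covered-by-simplicial simplicial (∈-closedNbhd⁺ G (inj₂ (adj-sym G u~v))) (∈-closedNbhd⁺ G (inj₁ refl))
  ... | no _ | no _ | yes (s , simplicial , s~u , s~v) =
    covered-by-simplicial simplicial (∈-closedNbhd⁺ G (inj₂ s~u)) (∈-closedNbhd⁺ G (inj₂ s~v))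
  ... | no ¬simplicial-u | no ¬simplicial-v | no ¬share
    with C , C∈ , u∈C , v∈C ← covers (∈-nonSimplicials ¬simplicial-u) (∈-nonSimplicials ¬simplicial-v) u~v ¬share =
    C , ∈-++⁺ʳ (simplicialCliques G) C∈ , u∈C , v∈C

  cover-bound : ∀ {v a} → NonIsolated G v → IsAlpha G v a → val cover v * a + n ≤ suc n * a
  cover-bound {v} {a} (u , v~u) isAlpha rewrite val-++ (simplicialCliques G) (proj₁ core) v with simplicial? G v
  ... | yes simplicial =
    bound-valency≤1 {m = n} 1≤a (subst (_≤ 1) (sym val≡leadersAt) (leadersAt-simplicial≤1 G simplicial))
    where
    1≤a : 1 ≤ a
    1≤a = alphaAtLeast⇒≤α G (u ∷ [] , (v~u ∷ [] , [] ∷ []) , s≤s z≤n) isAlpha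
    val≡leadersAt : val (simplicialCliques G) v + val (proj₁ core) v ≡ length (leadersAt G v)
    val≡leadersAt = trans (cong₂ _+_ (val-simplicialCliques G v)
                                (val-none (proj₁ core) (λ C∈ v∈ → proj₂ (∈-filter⁻ (¬? ∘ simplicial? G) {xs = allFin n}
                                                                                      (inside C∈ v∈)) simplicial)))
                     (+-identityʳ _)
  ... | no ¬simplicial with good-at s α≥s 2≤s bound ← good (∈-nonSimplicials ¬simplicial) =
    bound-mono-α {k = k} 1≤s (alphaAtLeast⇒≤α G α≥s isAlpha) (bound-mono-order {k = k} 1≤s order≤n bound)
    where
    k = val (simplicialCliques G) v + val (proj₁ core) v
    1≤s = ≤-trans (s≤s z≤n) 2≤s
    order≤n : order G nonSimplicials ≤ n
    order≤n = ≤-trans (length-filter-disjoint (¬? ∘ simplicial? G) (simplicial? G) (λ ¬s s → ¬s s) (allFin n))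
                      (≤-reflexive (length-tabulate _))

theorem7 : (n : ℕ) → (G : Graph n) →
    ∃ λ (𝒞 : List (Subset n)) → IsCliqueCovering G 𝒞 ×
      (∀ v → NonIsolated G v → ∀ a → IsAlpha G v a →
        val 𝒞 v * a + n ≤ suc n * a)
theorem7 n G =
  cover G , (cover-cliques G , cover-covers G) , λ _ nonIsolated _ isAlpha → cover-bound G nonIsolated isAlpha
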